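{- For every $N\ge1$ and every sequence of integers $k_0,\dots,k_{N-1}\ge1$ with $k_0>1$, the rooted focal unfolding cycle $(\mathbf{FC}_{(k_i)_{i=0}^{N-1}},R)$ admits an actual labelling.
   Context: Graphs are directed multigraphs $G=(VG,EG,o,t)$. Focal unfolding cycle: for $N\ge1$ and integers $k_0,\dots,k_{N-1}\ge1$ with $k_0>1$, $\mathbf{FC}_{(k_i)_{i=0}^{N-1}}$ has vertices $v_0,\dots,v_{N-1},w_0,\dots,w_{N-1},R$ and edges: $k_i$ edges from $v_i$ to $v_{i+1\bmod N}$; $k_i-1$ edges from $w_i$ to $v_{i+1\bmod N}$; one edge from $w_i$ to $w_{i-1\bmod N}$ (for each $0\le i<N$); $k_0$ edges from $R$ to $v_{1\bmod N}$; and one edge from $R$ to $w_{N-1}$. It is rooted at $R$. Multisets over $X$ have positive integer multiplicities; union adds multiplicities; $M\setminus\{x\}$ removes one copy. $t_m(o^{ -1}(v))$ is the multiset of termini of edges leaving $v$ counted with the number of edges; $l(t_m(o^{ -1}(v)))$ its multiset of labels. Actual labelling of a rooted graph $(G,R)$ with $t^{ -1}(R)=\emptyset$: a finite set $X$, maps $l:VG\to X$, $l_p:VG\setminus\{R\}\to X$, and multisets $M_x$ ($x\in X$) such that for all $v\neq R$: (1) $l_p(v)\in M_{l(v)}$; (2) $l(t_m(o^{ -1}(v)))=M_{l(v)}\setminus\{l_p(v)\}$; (3) $l(o(e))=l_p(v)$ for all edges $e$ with $t(e)=v$; and (4) $l(t_m(o^{ -1}(R)))=M_{l(R)}$. -}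

module Defs where

open import Data.Nat using (ℕ; zero; suc; _+_; _∸_; _≤_; _<_)
open import Data.Nat.DivMod using (_mod_)
open import Data.Fin using (Fin; toℕ; fromℕ)
import Data.Fin.Properties as FinP
open import Data.List using (List; allFin; []; _∷_; _++_; replicate; concatMap; length; filter)
open import Data.List.Membership.Propositional using (_∈_)
open import Data.List.Relation.Unary.Any using (Any)
open import Data.Product using (_×_; _,_; proj₁; proj₂; Σ)
open import Relation.Binary.Definitions using (DecidableEquality)
open import Relation.Binary.PropositionalEquality using (_≡_; _≢_; refl; cong)
open import Relation.Nullary using (yes; no)
open import Relation.Nullary.Decidable using (_×-dec_)

-- Repeated entries are parallel edges.

record Graph : Set₁ where
  field
    V     : Set
    _≟V_  : DecidableEquality V
    edges : List (V × V)

  o : V × V → V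
  o = proj₁

  t : V × V → V
  t = proj₂

open Graph public

-- Finite multisets over a finite label set X = Fin m, represented by
-- their multiplicity function (an element with multiplicity 0 is absent).

Multiset : ℕ → Set
Multiset m = Fin m → ℕ

_∈ₘ_ : {m : ℕ} → Fin m → Multiset m → Set
x ∈ₘ M = 1 ≤ M x

_∖₁_ : {m : ℕ} → Multiset m → Fin m → Multiset m
(M ∖₁ x) z with z FinP.≟ x
... | yes _ = M z ∸ 1
... | no  _ = M z

-- l(t_m(o^{-1}(v))): the multiset of labels of termini of edges leaving v,
-- counted with the number of edges.
outLabels : (G : Graph) {m : ℕ} → (V G → Fin m) → V G → Multiset m
outLabels G l v z =
  length (filter (λ e → (proj₁ e ≟ v) ×-dec (l (proj₂ e) FinP.≟ z)) (edges G))
  where open Graph G using () renaming (_≟V_ to _≟_)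

-- Actual labelling of a rooted graph (G , R), with label set X = Fin m.
-- l_p is given as a total map but only its values on v ≠ R matter.

record ActualLabelling (G : Graph) (R : V G) : Set where
  field
    m   : ℕ
    l   : V G → Fin m
    lp  : V G → Fin m
    M   : Fin m → Multiset m
    c1  : ∀ v → v ≢ R → lp v ∈ₘ M (l v)
    c2  : ∀ v → v ≢ R → ∀ z → outLabels G l v z ≡ (M (l v) ∖₁ lp v) z
    c3  : ∀ v → v ≢ R → ∀ e → e ∈ edges G → proj₂ e ≡ v → l (proj₁ e) ≡ lp v
    c4  : ∀ z → outLabels G l R z ≡ M (l R) z

-- Focal unfolding cycle FC_{(k_i)} with N = suc n.

data FCVertex (n : ℕ) : Set where
  v : Fin (suc n) → FCVertex n
  w : Fin (suc n) → FCVertex n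
  R : FCVertex n

_≟FC_ : {n : ℕ} → DecidableEquality (FCVertex n)
v i ≟FC v j with i FinP.≟ j
... | yes refl = yes refl
... | no  p    = no λ { refl → p refl }
v i ≟FC w j = no λ ()
v i ≟FC R   = no λ ()
w i ≟FC v j = no λ ()
w i ≟FC w j with i FinP.≟ j
... | yes refl = yes refl
... | no  p    = no λ { refl → p refl }
w i ≟FC R   = no λ ()
R ≟FC v j   = no λ ()
R ≟FC w j   = no λ ()
R ≟FC R     = yes refl

sucMod : {n : ℕ} → Fin (suc n) → Fin (suc n)
sucMod {n} i = suc (toℕ i) mod (suc n)

predMod : {n : ℕ} → Fin (suc n) → Fin (suc n)
predMod {n} i = (toℕ i + n) mod (suc n)

allFins : (n : ℕ) → List (Fin n)
allFins n = allFin n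

FCedges : (n : ℕ) → (Fin (suc n) → ℕ) → List (FCVertex n × FCVertex n)
FCedges n k =
  concatMap (λ i → replicate (k i) (v i , v (sucMod i))
                ++ replicate (k i ∸ 1) (w i , v (sucMod i))
                ++ ((w i , w (predMod i)) ∷ []))
            (allFins (suc n))
  ++ replicate (k Data.Fin.zero) (R , v (1 mod (suc n)))
  ++ ((R , w (fromℕ n)) ∷ [])

FC : (n : ℕ) → (Fin (suc n) → ℕ) → Graph
FC n k = record { V = FCVertex n ; _≟V_ = _≟FC_ ; edges = FCedges n k }

-- Indices are mod N.  Label v i and w i by i and the root by 0, and let
-- M_x = {x − 1} + k_x·{x + 1}.  Every edge into v j comes from a vertex labelled j − 1 and every
-- edge into w j from one labelled j + 1, so l_p(v j) = j − 1 and l_p(w j) = j + 1.  The out-labels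
-- are k_i copies of i + 1 at v i; k_i − 1 copies of i + 1 and one i − 1 at w i (this is where
-- 1 ≤ k_i is needed); and k_0 copies of 1 and one N − 1 = 0 − 1 at R: each is M_{l(u)} with l_p(u)
-- removed, resp. M_0 itself.  Multisets are compared as lists up to permutation.
module Submission where

open import Defs
open import Data.Nat using (ℕ; suc; _+_; _∸_; _≤_; _<_; s≤s; z≤n; NonZero)
open import Data.Nat.Properties using (n<1+n; +-suc; +-comm)
open import Data.Nat.DivMod using (_%_; _mod_; %-distribˡ-+; m%n%n≡m%n; [m+n]%n≡m%n; m<n⇒m%n≡m)
open import Data.Fin using (Fin; zero; toℕ; fromℕ)
import Data.Fin as Fin
open import Data.Fin.Properties using (suc-injective; toℕ-injective; toℕ-fromℕ; toℕ-fromℕ<; toℕ<n) renaming (_≟_ to _≟ᶠ_)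
open import Data.List using (List; []; _∷_; _++_; _∷ʳ_; map; concat; replicate; filter; length; tabulate)
open import Data.List.Properties
  using (filter-++; filter-all; filter-none; filter-accept; filter-reject; length-map; map-++; map-replicate; map-tabulate; ++-identityʳ)
open import Data.List.Relation.Unary.All as All using (All; []; _∷_)
import Data.List.Relation.Unary.All.Properties as All
open import Data.List.Relation.Binary.Permutation.Propositional
  using (_↭_; ↭-refl; ↭-reflexive; ↭-prep; ↭-swap; module PermutationReasoning)
open import Data.List.Relation.Binary.Permutation.Propositional.Properties using (filter-↭; ↭-length; ∷↭∷ʳ)
open import Data.Empty using (⊥-elim)
open import Data.Product using (_×_; _,_; proj₁; proj₂)
open import Function using (_∘_)
open import Level using (Level)
open import Relation.Binary.PropositionalEquality
open import Relation.Nullary using (yes; no)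
open import Relation.Nullary.Decidable using (_×-dec_)
open import Relation.Unary using (Pred; Decidable)

private variable
  a p q : Level
  A B : Set a

module _ {P : Pred A p} (P? : Decidable P) where

  filter-map : (f : B → A) (xs : List B) → filter P? (map f xs) ≡ map f (filter (P? ∘ f) xs)
  filter-map f [] = refl
  filter-map f (x ∷ xs) with P? (f x)
  ... | yes _ = cong (f x ∷_) (filter-map f xs)
  ... | no  _ = filter-map f xs

  filter-concat-tabulate : ∀ {m} (f : Fin m → List A) →
    filter P? (concat (tabulate f)) ≡ concat (tabulate (filter P? ∘ f))
  filter-concat-tabulate {m = 0}     f = refl
  filter-concat-tabulate {m = suc m} f =
    trans (filter-++ P? (f zero) _) (cong (filter P? (f zero) ++_) (filter-concat-tabulate (f ∘ Fin.suc)))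

  module _ {Q : Pred A q} (Q? : Decidable Q) where

    filter-×-dec : (xs : List A) → filter (λ x → P? x ×-dec Q? x) xs ≡ filter Q? (filter P? xs)
    filter-×-dec [] = refl
    filter-×-dec (x ∷ xs) with P? x
    ... | no  _ = filter-×-dec xs
    ... | yes _ with Q? x
    ...   | yes _ = cong (x ∷_) (filter-×-dec xs)
    ...   | no  _ = filter-×-dec xs

concat-tabulate-[] : ∀ {m} (f : Fin m → List A) → (∀ i → f i ≡ []) → concat (tabulate f) ≡ []
concat-tabulate-[] {m = 0}     f f≡[] = refl
concat-tabulate-[] {m = suc m} f f≡[] =
  cong₂ _++_ (f≡[] zero) (concat-tabulate-[] (f ∘ Fin.suc) (f≡[] ∘ Fin.suc))

concat-tabulate-single : ∀ {m} (f : Fin m → List A) j → (∀ i → i ≢ j → f i ≡ []) →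
  concat (tabulate f) ≡ f j
concat-tabulate-single f zero f≡[] =
  trans (cong (f zero ++_) (concat-tabulate-[] (f ∘ Fin.suc) (λ i → f≡[] (Fin.suc i) λ ())))
        (++-identityʳ (f zero))
concat-tabulate-single f (Fin.suc j) f≡[] =
  cong₂ _++_ (f≡[] zero λ ())
             (concat-tabulate-single (f ∘ Fin.suc) j (λ i i≢j → f≡[] (Fin.suc i) (i≢j ∘ suc-injective)))

replicate-∸1 : ∀ {m} (x : A) → 1 ≤ m → replicate m x ≡ x ∷ replicate (m ∸ 1) x
replicate-∸1 x (s≤s z≤n) = refl

toMultiset : ∀ {m} → List (Fin m) → Multiset m
toMultiset xs z = length (filter (_≟ᶠ z) xs)

toMultiset-↭ : ∀ {m} {xs ys : List (Fin m)} → xs ↭ ys → ∀ z → toMultiset xs z ≡ toMultiset ys z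
toMultiset-↭ xs↭ys z = ↭-length (filter-↭ (_≟ᶠ z) xs↭ys)

module _ {m} {xs ys : List (Fin m)} {x : Fin m} (xs↭x∷ys : xs ↭ x ∷ ys) where

  ∈ₘ-toMultiset : x ∈ₘ toMultiset xs
  ∈ₘ-toMultiset rewrite toMultiset-↭ xs↭x∷ys x | filter-accept (_≟ᶠ x) {xs = ys} refl = s≤s z≤n

  toMultiset-∖₁ : ∀ z → (toMultiset xs ∖₁ x) z ≡ toMultiset ys z
  toMultiset-∖₁ z with z ≟ᶠ x
  ... | yes refl rewrite toMultiset-↭ xs↭x∷ys z | filter-accept (_≟ᶠ z) {xs = ys} refl = refl
  ... | no z≢x   rewrite toMultiset-↭ xs↭x∷ys z | filter-reject (_≟ᶠ z) {xs = ys} (z≢x ∘ sym) = refl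

outLabels-toMultiset : (G : Graph) {m : ℕ} (l : V G → Fin m) (u : V G) (z : Fin m) →
  outLabels G l u z ≡ toMultiset (map (l ∘ t G) (filter (λ e → _≟V_ G (o G e) u) (edges G))) z
outLabels-toMultiset G l u z = begin
  length (filter (λ e → from? e ×-dec labelled? e) (edges G))
    ≡⟨ cong length (filter-×-dec from? labelled? (edges G)) ⟩
  length (filter labelled? (filter from? (edges G)))
    ≡⟨ length-map (l ∘ t G) (filter labelled? (filter from? (edges G))) ⟨
  length (map (l ∘ t G) (filter labelled? (filter from? (edges G))))
    ≡⟨ cong length (filter-map (_≟ᶠ z) (l ∘ t G) (filter from? (edges G))) ⟨
  toMultiset (map (l ∘ t G) (filter from? (edges G))) z
    ∎
  where
  open ≡-Reasoning
  from? : Decidable (λ e → o G e ≡ u)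
  from? e = _≟V_ G (o G e) u
  labelled? : Decidable (λ e → l (t G e) ≡ z)
  labelled? e = l (t G e) ≟ᶠ z

[m%d+n]%d≡[m+n]%d : ∀ m n d .{{_ : NonZero d}} → (m % d + n) % d ≡ (m + n) % d
[m%d+n]%d≡[m+n]%d m n d = begin
  (m % d + n) % d          ≡⟨ %-distribˡ-+ (m % d) n d ⟩
  (m % d % d + n % d) % d  ≡⟨ cong (λ x → (x + n % d) % d) (m%n%n≡m%n m d) ⟩
  (m % d + n % d) % d      ≡⟨ %-distribˡ-+ m n d ⟨
  (m + n) % d              ∎
  where open ≡-Reasoning

[m+n%d]%d≡[m+n]%d : ∀ m n d .{{_ : NonZero d}} → (m + n % d) % d ≡ (m + n) % d
[m+n%d]%d≡[m+n]%d m n d = begin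
  (m + n % d) % d  ≡⟨ cong (_% d) (+-comm m (n % d)) ⟩
  (n % d + m) % d  ≡⟨ [m%d+n]%d≡[m+n]%d n m d ⟩
  (n + m) % d      ≡⟨ cong (_% d) (+-comm n m) ⟩
  (m + n) % d      ∎
  where open ≡-Reasoning

module _ {n : ℕ} where

  private
    toℕ-mod : ∀ m → toℕ (m mod suc n) ≡ m % suc n
    toℕ-mod m = toℕ-fromℕ< _

    [i+1+n]%[1+n]≡i : (i : Fin (suc n)) → (toℕ i + suc n) % suc n ≡ toℕ i
    [i+1+n]%[1+n]≡i i = trans ([m+n]%n≡m%n (toℕ i) (suc n)) (m<n⇒m%n≡m (toℕ<n i))

  predMod-sucMod : (i : Fin (suc n)) → predMod (sucMod i) ≡ i
  predMod-sucMod i = toℕ-injective (begin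
    toℕ (predMod (sucMod i))                ≡⟨ toℕ-mod (toℕ (sucMod i) + n) ⟩
    (toℕ (sucMod i) + n) % suc n            ≡⟨ cong (λ x → (x + n) % suc n) (toℕ-mod (suc (toℕ i))) ⟩
    (suc (toℕ i) % suc n + n) % suc n       ≡⟨ [m%d+n]%d≡[m+n]%d (suc (toℕ i)) n (suc n) ⟩
    suc (toℕ i + n) % suc n                 ≡⟨ cong (_% suc n) (+-suc (toℕ i) n) ⟨
    (toℕ i + suc n) % suc n                 ≡⟨ [i+1+n]%[1+n]≡i i ⟩
    toℕ i                                   ∎)
    where open ≡-Reasoning

  sucMod-predMod : (i : Fin (suc n)) → sucMod (predMod i) ≡ i
  sucMod-predMod i = toℕ-injective (begin
    toℕ (sucMod (predMod i))                ≡⟨ toℕ-mod (suc (toℕ (predMod i))) ⟩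
    suc (toℕ (predMod i)) % suc n           ≡⟨ cong (λ x → suc x % suc n) (toℕ-mod (toℕ i + n)) ⟩
    (1 + (toℕ i + n) % suc n) % suc n       ≡⟨ [m+n%d]%d≡[m+n]%d 1 (toℕ i + n) (suc n) ⟩
    suc (toℕ i + n) % suc n                 ≡⟨ cong (_% suc n) (+-suc (toℕ i) n) ⟨
    (toℕ i + suc n) % suc n                 ≡⟨ [i+1+n]%[1+n]≡i i ⟩
    toℕ i                                   ∎)
    where open ≡-Reasoning

  fromℕ≡predMod-zero : fromℕ n ≡ predMod zero
  fromℕ≡predMod-zero = toℕ-injective (begin
    toℕ (fromℕ n)   ≡⟨ toℕ-fromℕ n ⟩
    n               ≡⟨ m<n⇒m%n≡m (n<1+n n) ⟨
    n % suc n       ≡⟨ toℕ-mod n ⟨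
    toℕ (predMod {n} zero) ∎)
    where open ≡-Reasoning

module FocalCycle (n : ℕ) (k : Fin (suc n) → ℕ) where

  Edge : Set
  Edge = FCVertex n × FCVertex n

  leaving : FCVertex n → List Edge
  leaving (v i) = replicate (k i) (v i , v (sucMod i))
  leaving (w i) = replicate (k i ∸ 1) (w i , v (sucMod i)) ++ ((w i , w (predMod i)) ∷ [])
  leaving R     = replicate (k zero) (R , v (sucMod zero)) ++ ((R , w (fromℕ n)) ∷ [])

  block : Fin (suc n) → List Edge
  block i = leaving (v i) ++ leaving (w i)

  FCedges≡blocks : FCedges n k ≡ concat (tabulate block) ++ leaving R
  FCedges≡blocks = cong (λ bs → concat bs ++ leaving R) (map-tabulate (λ i → i) block)

  from? : (u : FCVertex n) → Decidable (λ (e : Edge) → proj₁ e ≡ u)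
  from? u e = proj₁ e ≟FC u

  leaving-from : ∀ u → All (λ e → proj₁ e ≡ u) (leaving u)
  leaving-from (v i) = All.replicate⁺ (k i) refl
  leaving-from (w i) = All.++⁺ (All.replicate⁺ (k i ∸ 1) refl) (refl ∷ [])
  leaving-from R     = All.++⁺ (All.replicate⁺ (k zero) refl) (refl ∷ [])

  filter-from-leaving : ∀ u → filter (from? u) (leaving u) ≡ leaving u
  filter-from-leaving u = filter-all (from? u) (leaving-from u)

  filter-from-leaving-≢ : ∀ a u → a ≢ u → filter (from? u) (leaving a) ≡ []
  filter-from-leaving-≢ a u a≢u =
    filter-none (from? u) (All.map (λ o≡a o≡u → a≢u (trans (sym o≡a) o≡u)) (leaving-from a))

  filter-from-block-≢ : ∀ i u → v i ≢ u → w i ≢ u → filter (from? u) (block i) ≡ []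
  filter-from-block-≢ i u vi≢u wi≢u =
    trans (filter-++ (from? u) (leaving (v i)) (leaving (w i)))
          (cong₂ _++_ (filter-from-leaving-≢ (v i) u vi≢u) (filter-from-leaving-≢ (w i) u wi≢u))

  filter-from-block-v : ∀ j → filter (from? (v j)) (block j) ≡ leaving (v j)
  filter-from-block-v j = begin
    filter (from? (v j)) (block j)
      ≡⟨ filter-++ (from? (v j)) (leaving (v j)) (leaving (w j)) ⟩
    filter (from? (v j)) (leaving (v j)) ++ filter (from? (v j)) (leaving (w j))
      ≡⟨ cong₂ _++_ (filter-from-leaving (v j)) (filter-from-leaving-≢ (w j) (v j) (λ ())) ⟩
    leaving (v j) ++ []
      ≡⟨ ++-identityʳ (leaving (v j)) ⟩
    leaving (v j)
      ∎
    where open ≡-Reasoning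

  filter-from-block-w : ∀ j → filter (from? (w j)) (block j) ≡ leaving (w j)
  filter-from-block-w j = begin
    filter (from? (w j)) (block j)
      ≡⟨ filter-++ (from? (w j)) (leaving (v j)) (leaving (w j)) ⟩
    filter (from? (w j)) (leaving (v j)) ++ filter (from? (w j)) (leaving (w j))
      ≡⟨ cong₂ _++_ (filter-from-leaving-≢ (v j) (w j) (λ ())) (filter-from-leaving (w j)) ⟩
    leaving (w j)
      ∎
    where open ≡-Reasoning

  filter-from-FCedges : ∀ u → filter (from? u) (FCedges n k) ≡ leaving u
  filter-from-FCedges u = begin
    filter (from? u) (FCedges n k)
      ≡⟨ cong (filter (from? u)) FCedges≡blocks ⟩
    filter (from? u) (concat (tabulate block) ++ leaving R)
      ≡⟨ filter-++ (from? u) (concat (tabulate block)) (leaving R) ⟩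
    filter (from? u) (concat (tabulate block)) ++ filter (from? u) (leaving R)
      ≡⟨ cong (_++ filter (from? u) (leaving R)) (filter-concat-tabulate (from? u) block) ⟩
    concat (tabulate (filter (from? u) ∘ block)) ++ filter (from? u) (leaving R)
      ≡⟨ select u ⟩
    leaving u
      ∎
    where
    open ≡-Reasoning
    select : ∀ u → concat (tabulate (filter (from? u) ∘ block)) ++ filter (from? u) (leaving R) ≡ leaving u
    select R = cong₂ _++_
      (concat-tabulate-[] (filter (from? R) ∘ block) (λ i → filter-from-block-≢ i R (λ ()) (λ ())))
      (filter-from-leaving R)
    select (v j) = trans
      (cong₂ _++_ (trans (concat-tabulate-single (filter (from? (v j)) ∘ block) j
                            (λ i i≢j → filter-from-block-≢ i (v j) (λ { refl → i≢j refl }) (λ ())))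
                         (filter-from-block-v j))
                  (filter-from-leaving-≢ R (v j) (λ ())))
      (++-identityʳ (leaving (v j)))
    select (w j) = trans
      (cong₂ _++_ (trans (concat-tabulate-single (filter (from? (w j)) ∘ block) j
                            (λ i i≢j → filter-from-block-≢ i (w j) (λ ()) (λ { refl → i≢j refl })))
                         (filter-from-block-w j))
                  (filter-from-leaving-≢ R (w j) (λ ())))
      (++-identityʳ (leaving (w j)))

  label : FCVertex n → Fin (suc n)
  label (v i) = i
  label (w i) = i
  label R     = zero

  parentLabel : FCVertex n → Fin (suc n)
  parentLabel (v i) = predMod i
  parentLabel (w i) = sucMod i
  parentLabel R     = zero

  M-elements : Fin (suc n) → List (Fin (suc n))
  M-elements x = predMod x ∷ replicate (k x) (sucMod x)

  M : Fin (suc n) → Multiset (suc n)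
  M x = toMultiset (M-elements x)

  outList : FCVertex n → List (Fin (suc n))
  outList u = map (label ∘ proj₂) (leaving u)

  outLabels≡toMultiset-outList : ∀ u z → outLabels (FC n k) label u z ≡ toMultiset (outList u) z
  outLabels≡toMultiset-outList u z =
    trans (outLabels-toMultiset (FC n k) label u z)
          (cong (λ es → toMultiset (map (label ∘ proj₂) es) z) (filter-from-FCedges u))

  outList-w : ∀ i → outList (w i) ≡ replicate (k i ∸ 1) (sucMod i) ∷ʳ predMod i
  outList-w i = trans (map-++ (label ∘ proj₂) (replicate (k i ∸ 1) (w i , v (sucMod i))) _)
                      (cong (_∷ʳ predMod i) (map-replicate (label ∘ proj₂) (k i ∸ 1) (w i , v (sucMod i))))

  outList-R : outList R ≡ replicate (k zero) (sucMod zero) ∷ʳ fromℕ n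
  outList-R = trans (map-++ (label ∘ proj₂) (replicate (k zero) (R , v (sucMod zero))) _)
                    (cong (_∷ʳ fromℕ n) (map-replicate (label ∘ proj₂) (k zero) (R , v (sucMod zero))))

  M-elements-↭ : (∀ i → 1 ≤ k i) → ∀ u → u ≢ R → M-elements (label u) ↭ parentLabel u ∷ outList u
  M-elements-↭ k≥1 (v i) _ =
    ↭-reflexive (cong (predMod i ∷_) (sym (map-replicate (label ∘ proj₂) (k i) (v i , v (sucMod i)))))
  M-elements-↭ k≥1 (w i) _ = begin
    predMod i ∷ replicate (k i) (sucMod i)                   ≡⟨ cong (predMod i ∷_) (replicate-∸1 (sucMod i) (k≥1 i)) ⟩
    predMod i ∷ sucMod i ∷ rest                              ↭⟨ ↭-swap (predMod i) (sucMod i) ↭-refl ⟩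
    sucMod i ∷ predMod i ∷ rest                              ↭⟨ ↭-prep (sucMod i) (∷↭∷ʳ (predMod i) rest) ⟩
    sucMod i ∷ (rest ∷ʳ predMod i)                           ≡⟨ cong (sucMod i ∷_) (outList-w i) ⟨
    sucMod i ∷ outList (w i)                                 ∎
    where
    open PermutationReasoning
    rest : List (Fin (suc n))
    rest = replicate (k i ∸ 1) (sucMod i)
  M-elements-↭ k≥1 R R≢R = ⊥-elim (R≢R refl)

  M-elements-root : M-elements zero ↭ outList R
  M-elements-root = begin
    predMod zero ∷ replicate (k zero) (sucMod zero)   ↭⟨ ∷↭∷ʳ (predMod zero) (replicate (k zero) (sucMod zero)) ⟩
    replicate (k zero) (sucMod zero) ∷ʳ predMod zero  ≡⟨ cong (replicate (k zero) (sucMod zero) ∷ʳ_) fromℕ≡predMod-zero ⟨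
    replicate (k zero) (sucMod zero) ∷ʳ fromℕ n       ≡⟨ outList-R ⟨
    outList R                                         ∎
    where open PermutationReasoning

  leaving-consistent : ∀ u → All (λ e → label (proj₁ e) ≡ parentLabel (proj₂ e)) (leaving u)
  leaving-consistent (v i) = All.replicate⁺ (k i) (sym (predMod-sucMod i))
  leaving-consistent (w i) =
    All.++⁺ (All.replicate⁺ (k i ∸ 1) (sym (predMod-sucMod i))) (sym (sucMod-predMod i) ∷ [])
  leaving-consistent R =
    All.++⁺ (All.replicate⁺ (k zero) (sym (predMod-sucMod zero)))
            (trans (sym (sucMod-predMod zero)) (cong sucMod (sym fromℕ≡predMod-zero)) ∷ [])

  FCedges-consistent : All (λ e → label (proj₁ e) ≡ parentLabel (proj₂ e)) (FCedges n k)
  FCedges-consistent = subst (All _) (sym FCedges≡blocks)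
    (All.++⁺ (All.concat⁺ (All.tabulate⁺ λ i → All.++⁺ (leaving-consistent (v i)) (leaving-consistent (w i))))
             (leaving-consistent R))

lemma15 : (n : ℕ) (k : Fin (suc n) → ℕ) → (∀ i → 1 ≤ k i) → 1 < k zero →
    ActualLabelling (FC n k) R
lemma15 n k k≥1 _ = record
  { m  = suc n
  ; l  = label
  ; lp = parentLabel
  ; M  = M
  ; c1 = λ u u≢R → ∈ₘ-toMultiset (M-elements-↭ k≥1 u u≢R)
  ; c2 = λ u u≢R z →
      trans (outLabels≡toMultiset-outList u z) (sym (toMultiset-∖₁ (M-elements-↭ k≥1 u u≢R) z))
  ; c3 = λ { _ _ (_ , _) e∈ refl → All.lookup FCedges-consistent e∈ }
  ; c4 = λ z → trans (outLabels≡toMultiset-outList R z) (sym (toMultiset-↭ M-elements-root z))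
  }
  where open FocalCycle n k
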